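{- Let $q$ be even, $q>2$, let $\Sigma_\infty$ be a hyperplane of $\mathrm{PG}(4,q)$, and let $\mathcal{C}$ be a set of $q^2$ affine points ($\mathcal{C}$-points) together with a set of planes ($\mathcal{C}$-planes) satisfying (A1)–(A4). Then the incidence structure $\mathcal{A}$ whose points are the $\mathcal{C}$-points, whose lines are the $\mathcal{C}$-planes, with incidence given by containment, is an affine plane of order $q$.
   Context: Affine points are points of $\mathrm{PG}(4,q)\setminus\Sigma_\infty$. Conditions: (A1) each $\mathcal{C}$-plane meets $\mathcal{C}$ in a $q$-arc (q points, no three collinear); (A2) any two distinct $\mathcal{C}$-points lie in a unique $\mathcal{C}$-plane; (A3) every affine point not in $\mathcal{C}$ lies on exactly one $\mathcal{C}$-plane; (A4) every plane meeting $\mathcal{C}$ in at least three points either meets $\mathcal{C}$ in exactly four points or is a $\mathcal{C}$-plane. -}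

module Defs where

open import Level using (Level; _⊔_)
open import Data.Nat using (ℕ) renaming (_*_ to _*ℕ_)
open import Data.Fin using (Fin)
open import Data.Vec using (Vec; zipWith; foldr; replicate; lookup)
open import Data.List using (List; length)
open import Data.List.Relation.Unary.All using (All)
open import Data.List.Relation.Unary.Any using (Any)
open import Data.List.Relation.Unary.AllPairs using (AllPairs)
open import Data.Product using (Σ; ∃; ∃-syntax; _×_; _,_; proj₁)
open import Data.Sum using (_⊎_)
open import Relation.Nullary using (¬_)
open import Relation.Binary.PropositionalEquality using (_≡_; _≢_)
open import Function.Bundles using (_↔_)

record FiniteField : Set₁ where
  infixl 6 _+_
  infixl 7 _*_
  field
    Carrier : Set
    0# 1#   : Carrier
    _+_ _*_ : Carrier → Carrier → Carrier
    -_      : Carrier → Carrier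
    _⁻¹     : Carrier → Carrier
    +-assoc    : ∀ x y z → (x + y) + z ≡ x + (y + z)
    +-comm     : ∀ x y → x + y ≡ y + x
    +-identity : ∀ x → 0# + x ≡ x
    +-inverse  : ∀ x → (- x) + x ≡ 0#
    *-assoc    : ∀ x y z → (x * y) * z ≡ x * (y * z)
    *-comm     : ∀ x y → x * y ≡ y * x
    *-identity : ∀ x → 1# * x ≡ x
    distrib    : ∀ x y z → x * (y + z) ≡ (x * y) + (x * z)
    0≢1        : 0# ≢ 1#
    *-inverse  : ∀ x → x ≢ 0# → (x ⁻¹) * x ≡ 1#
    order      : ℕ
    enum       : Carrier ↔ Fin order

HasExactly : ∀ {a ℓ p} {A : Set a} (_≈_ : A → A → Set ℓ) (P : A → Set p) (k : ℕ) →
             Set (a ⊔ ℓ ⊔ p)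
HasExactly {A = A} _≈_ P k =
  Σ (List A) λ xs →
    length xs ≡ k ×
    All P xs ×
    AllPairs (λ x y → ¬ (x ≈ y)) xs ×
    (∀ x → P x → Any (x ≈_) xs)

record IsAffinePlaneOfOrder {a b ℓ₁ ℓ₂ i}
         (P : Set a) (_≈P_ : P → P → Set ℓ₁)
         (L : Set b) (_≈L_ : L → L → Set ℓ₂)
         (I : P → L → Set i) (n : ℕ) : Set (a ⊔ b ⊔ ℓ₁ ⊔ ℓ₂ ⊔ i) where
  Parallel : L → L → Set (a ⊔ i)
  Parallel l m = ¬ (∃[ p ] (I p l × I p m))
  Collinear3 : P → P → P → Set (b ⊔ i)
  Collinear3 p r s = ∃[ l ] (I p l × I r l × I s l)
  field
    join        : ∀ p r → ¬ (p ≈P r) → ∃[ l ] (I p l × I r l)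
    join-unique : ∀ p r → ¬ (p ≈P r) → ∀ l m →
                  I p l → I r l → I p m → I r m → l ≈L m
    parallel        : ∀ p l → ¬ I p l → ∃[ m ] (I p m × Parallel l m)
    parallel-unique : ∀ p l → ¬ I p l → ∀ m m' →
                      I p m → Parallel l m → I p m' → Parallel l m' → m ≈L m'
    nondegenerate : ∃[ p ] ∃[ r ] ∃[ s ] ¬ Collinear3 p r s
    line-size : ∀ l → HasExactly _≈P_ (λ p → I p l) n

-- A projective point is a nonzero vector of F^5 (up to scalars);
-- a projective subspace of (projective) dimension k-1 is a
-- k-dimensional vector subspace of F^5, represented by the predicate
-- of its vectors.

module PG4 (F : FiniteField) where
  open FiniteField F

  Vect : Set
  Vect = Vec Carrier 5

  0v : Vect
  0v = replicate 5 0#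

  _+v_ : Vect → Vect → Vect
  _+v_ = zipWith _+_

  _·v_ : Carrier → Vect → Vect
  c ·v x = Data.Vec.map (c *_) x

  lincomb : ∀ {k} → Vec Carrier k → Vec Vect k → Vect
  lincomb cs vs = foldr _ _+v_ 0v (zipWith _·v_ cs vs)

  LinIndep : ∀ {k} → Vec Vect k → Set
  LinIndep {k} vs = ∀ cs → lincomb cs vs ≡ 0v → ∀ (j : Fin k) → lookup cs j ≡ 0#

  Span : ∀ {k} → Vec Vect k → Vect → Set
  Span {k} vs x = ∃[ cs ] (x ≡ lincomb {k} cs vs)

  IsSubspace : ℕ → (Vect → Set) → Set
  IsSubspace k S = ∃[ vs ] (LinIndep {k} vs × (∀ x → (S x → Span vs x) × (Span vs x → S x)))

  IsLine IsPlane : (Vect → Set) → Set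
  IsLine  = IsSubspace 2
  IsPlane = IsSubspace 3

  _≐_ : (Vect → Set) → (Vect → Set) → Set
  S ≐ T = ∀ x → (S x → T x) × (T x → S x)

  Collinear : Vect → Vect → Vect → Set₁
  Collinear x y z = ∃[ l ] (IsLine l × l x × l y × l z)

  -- standard bilinear pairing; the hyperplane Σ∞ with coordinates h is
  -- { x | h · x = 0 }
  _∙_ : Vect → Vect → Carrier
  h ∙ x = foldr _ _+_ 0# (zipWith _*_ h x)

  -- An affine point (point of PG(4,q) \ Σ∞) is represented by its
  -- unique representative vector x with h ∙ x = 1.
  Affine : Vect → Vect → Set
  Affine h x = h ∙ x ≡ 1#

  record Hypotheses (h : Vect) (C : Vect → Set) (CPlane : (Vect → Set) → Set) : Set₁ where
    field
      C-affine    : ∀ x → C x → Affine h x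
      C-size      : HasExactly _≡_ C (order *ℕ order)
      CPlane-plane : ∀ π → CPlane π → IsPlane π
      CPlane-ext   : ∀ π ρ → π ≐ ρ → CPlane π → CPlane ρ
      A1-size : ∀ π → CPlane π → HasExactly _≡_ (λ x → C x × π x) order
      A1-arc  : ∀ π → CPlane π → ∀ x y z → C x → C y → C z → π x → π y → π z →
                x ≢ y → x ≢ z → y ≢ z → ¬ Collinear x y z
      A2        : ∀ x y → C x → C y → x ≢ y → ∃[ π ] (CPlane π × π x × π y)
      A2-unique : ∀ x y → C x → C y → x ≢ y → ∀ π ρ →
                  CPlane π → π x → π y → CPlane ρ → ρ x → ρ y → π ≐ ρ
      A3        : ∀ x → Affine h x → ¬ C x → ∃[ π ] (CPlane π × π x)
      A3-unique : ∀ x → Affine h x → ¬ C x → ∀ π ρ →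
                  CPlane π → π x → CPlane ρ → ρ x → π ≐ ρ
      A4 : ∀ π → IsPlane π →
           (∃[ x ] ∃[ y ] ∃[ z ] (C x × C y × C z × π x × π y × π z ×
                                   x ≢ y × x ≢ z × y ≢ z)) →
           HasExactly _≡_ (λ x → C x × π x) 4 ⊎ CPlane π

  APoint : (Vect → Set) → Set
  APoint C = Σ Vect C

  ALine : ((Vect → Set) → Set) → Set₁
  ALine CPlane = Σ (Vect → Set) CPlane

  _≈AP_ : ∀ {C} → APoint C → APoint C → Set
  p ≈AP r = proj₁ p ≡ proj₁ r

  _≈AL_ : ∀ {CPlane} → ALine CPlane → ALine CPlane → Set
  l ≈AL m = proj₁ l ≐ proj₁ m

  AInc : ∀ {C CPlane} → APoint C → ALine CPlane → Set
  AInc p l = proj₁ l (proj₁ p)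

-- Let x₀ be a point off a line l. The q lines joining x₀ to the points of l pairwise
-- meet only in x₀, so together they cover 1 + q(q − 1) < q² points; the line from x₀ to
-- an uncovered point misses l. Two parallels to l through x₀ meeting only in x₀ would
-- cover 2(q − 1) further points, and 1 + q(q − 1) + 2(q − 1) > q².

module Submission where

open import Defs
open import Level using (_⊔_)
open import Data.Nat using (ℕ; suc; pred; _+_; _*_; _≤_; _<_; _≮_; s≤s; s≤s⁻¹; z<s; >-nonZero)
open import Data.Nat.Properties
  using (module ≤-Reasoning; ≤-antisym; <⇒≤; <⇒≱; <-trans; *-suc; +-comm; +-monoˡ-≤; +-cancelˡ-≤; m+1+n≰m; m<m*n)
open import Data.Nat.Divisibility using (_∣_)
import Data.Fin.Properties as Fin
open import Data.Vec.Properties using (≡-dec)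
open import Data.List using (List; []; _∷_; [_]; _++_; length; filter; map)
open import Data.List.Properties using (length-++; length-map)
open import Data.List.Fresh using (fromList)
import Data.List.Fresh as List#
import Data.List.Fresh.Membership.Setoid as Fresh∈
import Data.List.Fresh.Membership.Setoid.Properties as Fresh∈ₚ
open import Data.List.Fresh.Relation.Unary.Any using () renaming (here to here#; there to there#)
open import Data.List.Relation.Unary.All as All using (All; []; _∷_)
import Data.List.Relation.Unary.All.Properties as All
open import Data.List.Relation.Unary.Any as Any using (here; there)
import Data.List.Relation.Unary.Any.Properties as Any
open import Data.List.Relation.Unary.AllPairs using ([]; _∷_)
import Data.List.Relation.Unary.AllPairs.Properties as AllPairs
open import Data.List.Relation.Unary.Unique.Propositional using (Unique)
import Data.List.Relation.Unary.Unique.Propositional.Properties as Unique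
open import Data.List.Membership.Propositional using (_∈_; _∉_; find; lose)
open import Data.List.Membership.Propositional.Properties
  using (∈-filter⁺; ∈-filter⁻; ∈-++⁺ˡ; ∈-++⁺ʳ; ∈-++⁻)
open import Data.List.Relation.Binary.Subset.Propositional using (_⊆_)
open import Data.List.Relation.Binary.Disjoint.Propositional using (Disjoint)
open import Data.Product using (Σ; Σ-syntax; ∃-syntax; _×_; _,_; proj₁; proj₂)
open import Data.Sum using (inj₁; inj₂)
open import Function using (_∘_)
open import Function.Properties.Inverse using (↔⇒↣)
open import Relation.Nullary using (¬_; yes; no; contradiction)
open import Relation.Nullary.Decidable using (¬?)
open import Relation.Binary.Definitions using (DecidableEquality)
open import Relation.Binary.PropositionalEquality
  using (_≡_; _≢_; refl; sym; trans; cong; cong₂; subst; subst₂; setoid)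

module _ {a} {A : Set a} where

  private
    length-fromList : ∀ {xs} (u : Unique xs) → List#.length (fromList {A = A} u) ≡ length xs
    length-fromList []      = refl
    length-fromList (_ ∷ u) = cong suc (length-fromList u)

    open Fresh∈ (setoid A) renaming (_∈_ to _∈#_)

    ∈-fromList⁺ : ∀ {x xs} (u : Unique xs) → x ∈ xs → x ∈# fromList u
    ∈-fromList⁺ (_ ∷ u) (here x≡y)  = here# x≡y
    ∈-fromList⁺ (_ ∷ u) (there x∈) = there# (∈-fromList⁺ u x∈)

    ∈-fromList⁻ : ∀ {x xs} (u : Unique xs) → x ∈# fromList u → x ∈ xs
    ∈-fromList⁻ (_ ∷ u) (here# x≡y)  = here x≡y
    ∈-fromList⁻ (_ ∷ u) (there# x∈) = there (∈-fromList⁻ u x∈)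

  ⊆⇒length≤ : ∀ {xs ys} → Unique xs → Unique ys → xs ⊆ ys → length xs ≤ length ys
  ⊆⇒length≤ {xs} {ys} u v xs⊆ys =
    subst₂ _≤_ (length-fromList u) (length-fromList v)
      (Fresh∈ₚ.injection (setoid A) (λ x≢y → x≢y) (∈-fromList⁺ v ∘ xs⊆ys ∘ ∈-fromList⁻ u))

module _ {a} {A : Set a} (_≟_ : DecidableEquality A) where

  open import Data.List.Membership.DecPropositional _≟_ using (_∈?_)

  length<⇒∃∉ : ∀ {xs ys} → Unique xs → Unique ys → length ys < length xs →
               ∃[ x ] x ∈ xs × x ∉ ys
  length<⇒∃∉ {xs} {ys} u v ys<xs with All.all? (_∈? ys) xs
  ... | yes xs⊆ys = contradiction (⊆⇒length≤ u v (All.lookup xs⊆ys)) (<⇒≱ ys<xs)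
  ... | no xs⊈ys  = find (All.¬All⇒Any¬ (_∈? ys) xs xs⊈ys)

  remove : A → List A → List A
  remove x = filter (λ y → ¬? (y ≟ x))

  remove-unique : ∀ x {xs} → Unique xs → Unique (remove x xs)
  remove-unique x = Unique.filter⁺ (λ y → ¬? (y ≟ x))

  ∈-remove⁺ : ∀ {x y xs} → y ∈ xs → y ≢ x → y ∈ remove x xs
  ∈-remove⁺ = ∈-filter⁺ (λ y → ¬? (y ≟ _))

  ∈-remove⁻ : ∀ {x y} xs → y ∈ remove x xs → y ∈ xs × y ≢ x
  ∈-remove⁻ {x} xs = ∈-filter⁻ (λ y → ¬? (y ≟ x)) {xs = xs}

  length-remove : ∀ {x xs} → Unique xs → x ∈ xs → length (remove x xs) ≡ pred (length xs)
  length-remove {x} {xs} u x∈xs = cong pred (≤-antisym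
    (⊆⇒length≤ unique-x∷ u λ { (here refl) → x∈xs ; (there y∈) → proj₁ (∈-remove⁻ xs y∈) })
    (⊆⇒length≤ u unique-x∷ x∷-complete))
    where
    unique-x∷ : Unique (x ∷ remove x xs)
    unique-x∷ = All.tabulate (λ y∈ x≡y → proj₂ (∈-remove⁻ xs y∈) (sym x≡y)) ∷ remove-unique x u

    x∷-complete : xs ⊆ x ∷ remove x xs
    x∷-complete {y} y∈xs with y ≟ x
    ... | yes refl = here refl
    ... | no y≢x   = there (∈-remove⁺ y∈xs y≢x)

module _ {a p q} {A : Set a} {P : A → Set p} {Q : A → Set q} where

  private
    map-proj₁-toList : ∀ {xs} (ps : All P xs) → map proj₁ (All.toList ps) ≡ xs
    map-proj₁-toList []       = refl
    map-proj₁-toList (_ ∷ ps) = cong (_ ∷_) (map-proj₁-toList ps)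

  HasExactly-Σ : ∀ {k} → HasExactly _≡_ (λ x → P x × Q x) k →
                 HasExactly (λ u v → proj₁ u ≡ proj₁ v) (λ u → Q (proj₁ u)) k
  HasExactly-Σ (xs , length-xs , pqs , unique , complete) =
    us , trans (sym (length-map proj₁ us)) (trans (cong length us≡xs) length-xs) ,
    All.map⁻ (subst (All Q) (sym us≡xs) (All.map proj₂ pqs)) ,
    AllPairs.map⁻ (subst Unique (sym us≡xs) unique) ,
    λ u qu → Any.map⁻ (subst (proj₁ u ∈_) (sym us≡xs) (complete (proj₁ u) (proj₂ u , qu)))
    where
    us : List (Σ A P)
    us = All.toList (All.map proj₁ pqs)

    us≡xs : map proj₁ us ≡ xs
    us≡xs = map-proj₁-toList (All.map proj₁ pqs)

module Enumeration {a p} {A : Set a} {P : A → Set p} {k} (e : HasExactly _≡_ P k) where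

  elements : List A
  elements = proj₁ e

  length-elements : length elements ≡ k
  length-elements = proj₁ (proj₂ e)

  all : All P elements
  all = proj₁ (proj₂ (proj₂ e))

  unique : Unique elements
  unique = proj₁ (proj₂ (proj₂ (proj₂ e)))

  complete : ∀ {x} → P x → x ∈ elements
  complete = proj₂ (proj₂ (proj₂ (proj₂ e))) _

private
  n*n≡n+n*pred-n : ∀ n → n * n ≡ n + n * pred n
  n*n≡n+n*pred-n 0       = refl
  n*n≡n+n*pred-n (suc k) = *-suc (suc k) k

  n<n*n : ∀ {n} → 1 < n → n < n * n
  n<n*n {n} 1<n = m<m*n n n {{>-nonZero (<-trans z<s 1<n)}} 1<n

  suc-n*pred-n<n*n : ∀ {n} → 1 < n → suc (n * pred n) < n * n
  suc-n*pred-n<n*n {n} 1<n =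
    subst (suc (suc (n * pred n)) ≤_) (sym (n*n≡n+n*pred-n n)) (+-monoˡ-≤ (n * pred n) 1<n)

  n*pred-n+2*pred-n≮n*n : ∀ {n} → 1 < n → n * pred n + (pred n + pred n) ≮ n * n
  n*pred-n+2*pred-n≮n*n {n@(suc p@(suc _))} (s≤s (s≤s _)) lt =
    m+1+n≰m p (+-cancelˡ-≤ (n * p) (p + p) p
      (subst (n * p + (p + p) ≤_) (+-comm p (n * p))
        (s≤s⁻¹ (subst (suc (n * p + (p + p)) ≤_) (n*n≡n+n*pred-n n) lt))))

record IsLinearSpace {a p b ℓ i} {A : Set a} (Pt : A → Set p) {L : Set b}
                     (_≈_ : L → L → Set ℓ) (I : A → L → Set i) : Set (a ⊔ p ⊔ b ⊔ ℓ ⊔ i) where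
  field
    join        : ∀ {x y} → Pt x → Pt y → x ≢ y → ∃[ l ] (I x l × I y l)
    join-unique : ∀ {x y} → Pt x → Pt y → x ≢ y →
                  ∀ {l m} → I x l → I y l → I x m → I y m → l ≈ m
    I-resp-≈    : ∀ {x l m} → l ≈ m → I x l → I x m

module SquareLinearSpace
  {a p b ℓ i} {A : Set a} (_≟_ : DecidableEquality A)
  {Pt : A → Set p} {L : Set b} {_≈_ : L → L → Set ℓ} {I : A → L → Set i}
  (linear : IsLinearSpace Pt _≈_ I) {n : ℕ} (1<n : 1 < n)
  (point-count : HasExactly _≡_ Pt (n * n))
  (line-size : ∀ l → HasExactly _≡_ (λ x → Pt x × I x l) n)
  where

  open IsLinearSpace linear
  open import Data.List.Membership.DecPropositional _≟_ using (_∈?_)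

  private
    module Points = Enumeration point-count
    module Line (l : L) = Enumeration (line-size l)

  Point : Set (a ⊔ p)
  Point = Σ A Pt

  Parallel : L → L → Set (a ⊔ p ⊔ i)
  Parallel l m = ¬ (Σ[ u ∈ Point ] (I (proj₁ u) l × I (proj₁ u) m))

  point-outside : ∀ {xs} → Unique xs → length xs < n * n → ∃[ x ] (Pt x × x ∉ xs)
  point-outside u xs<n*n =
    let x , x∈ , x∉ = length<⇒∃∉ _≟_ Points.unique u
                        (subst (_ <_) (sym Points.length-elements) xs<n*n)
    in x , All.lookup Points.all x∈ , x∉

  punctured : A → L → List A
  punctured x m = remove _≟_ x (Line.elements m)

  punctured-unique : ∀ x m → Unique (punctured x m)
  punctured-unique x m = remove-unique _≟_ x (Line.unique m)

  length-punctured : ∀ {x m} → Pt x → I x m → length (punctured x m) ≡ pred n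
  length-punctured {x} {m} px xm =
    trans (length-remove _≟_ (Line.unique m) (Line.complete m (px , xm)))
          (cong pred (Line.length-elements m))

  ∈-punctured⁺ : ∀ {x v m} → Pt v → I v m → v ≢ x → v ∈ punctured x m
  ∈-punctured⁺ {m = m} pv vm = ∈-remove⁺ _≟_ (Line.complete m (pv , vm))

  ∈-punctured⁻ : ∀ {x v m} → v ∈ punctured x m → Pt v × I v m × v ≢ x
  ∈-punctured⁻ {m = m} v∈ =
    let v∈m , v≢x = ∈-remove⁻ _≟_ (Line.elements m) v∈
        pv , vm = All.lookup (Line.all m) v∈m
    in pv , vm , v≢x

  two-points : ∃[ x ] ∃[ y ] (Pt x × Pt y × x ≢ y)
  two-points =
    let x , px , _  = point-outside {[]} [] (<-trans z<s 1<n*n)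
        y , py , y∉ = point-outside {[ x ]} ([] ∷ []) 1<n*n
    in x , y , px , py , λ x≡y → y∉ (here (sym x≡y))
    where
    1<n*n : 1 < n * n
    1<n*n = <-trans 1<n (n<n*n 1<n)

  point-off : ∀ l → ∃[ z ] (Pt z × ¬ I z l)
  point-off l =
    let z , pz , z∉l = point-outside (Line.unique l)
                         (subst (_< n * n) (sym (Line.length-elements l)) (n<n*n 1<n))
    in z , pz , λ zl → z∉l (Line.complete l (pz , zl))

  non-collinear-triple : Σ[ u ∈ Point ] Σ[ v ∈ Point ] Σ[ w ∈ Point ]
    ¬ (∃[ m ] (I (proj₁ u) m × I (proj₁ v) m × I (proj₁ w) m))
  non-collinear-triple =
    let x , y , px , py , x≢y = two-points
        l , xl , yl = join px py x≢y
        z , pz , ¬zl = point-off l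
    in (x , px) , (y , py) , (z , pz) ,
       λ (m , xm , ym , zm) → ¬zl (I-resp-≈ (join-unique px py x≢y xm ym xl yl) zm)

  module Parallels {x₀ l} (px₀ : Pt x₀) (x₀∉l : ¬ I x₀ l) where

    x₀≢ : ∀ {y} → I y l → x₀ ≢ y
    x₀≢ yl refl = x₀∉l yl

    ray : ∀ {y} → Pt y → I y l → ∃[ r ] (I x₀ r × I y r)
    ray py yl = join px₀ py (x₀≢ yl)

    cone : (ys : List A) → All (λ y → Pt y × I y l) ys → List A
    cone []      []                = []
    cone (_ ∷ _) ((py , yl) ∷ pys) = punctured x₀ (proj₁ (ray py yl)) ++ cone _ pys

    ∈-cone⁺ : ∀ {ys pys y v m} → y ∈ ys → I x₀ m → I y m → Pt v → v ≢ x₀ → I v m →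
              v ∈ cone ys pys
    ∈-cone⁺ {pys = (py , yl) ∷ _} (here refl) x₀m ym pv v≢x₀ vm =
      let r , x₀r , yr = ray py yl
      in ∈-++⁺ˡ (∈-punctured⁺ pv (I-resp-≈ (join-unique px₀ py (x₀≢ yl) x₀m ym x₀r yr) vm) v≢x₀)
    ∈-cone⁺ {pys = _ ∷ _} (there y∈ys) x₀m ym pv v≢x₀ vm =
      ∈-++⁺ʳ _ (∈-cone⁺ y∈ys x₀m ym pv v≢x₀ vm)

    ∈-cone⁻ : ∀ {ys pys v} → v ∈ cone ys pys →
              Pt v × v ≢ x₀ × (∀ {m} → I x₀ m → I v m → ∃[ y ] (y ∈ ys × I y m))
    ∈-cone⁻ {y ∷ _} {(py , yl) ∷ pys} v∈ with ∈-++⁻ (punctured x₀ (proj₁ (ray py yl))) v∈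
    ... | inj₁ v∈r =
      let r , x₀r , yr = ray py yl
          pv , vr , v≢x₀ = ∈-punctured⁻ v∈r
      in pv , v≢x₀ , λ x₀m vm →
           y , here refl , I-resp-≈ (join-unique px₀ pv (v≢x₀ ∘ sym) x₀r vr x₀m vm) yr
    ... | inj₂ v∈c =
      let pv , v≢x₀ , meets = ∈-cone⁻ {pys = pys} v∈c
      in pv , v≢x₀ , λ x₀m vm → let y , y∈ , ym = meets x₀m vm in y , there y∈ , ym

    cone-unique : ∀ {ys} (pys : All (λ y → Pt y × I y l) ys) → Unique ys → Unique (cone ys pys)
    cone-unique []                []              = []
    cone-unique ((py , yl) ∷ pys) (y∉ys ∷ unique) =
      let r , x₀r , yr = ray py yl
      in Unique.++⁺ (punctured-unique x₀ r) (cone-unique pys unique) λ (v∈r , v∈c) →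
           let _ , vr , _ = ∈-punctured⁻ v∈r
               y′ , y′∈ys , y′r = proj₂ (proj₂ (∈-cone⁻ v∈c)) x₀r vr
               py′ , y′l = All.lookup pys y′∈ys
           in x₀∉l (I-resp-≈ (join-unique py py′ (All.lookup y∉ys y′∈ys) yr y′r yl y′l) x₀r)

    length-cone : ∀ {ys} (pys : All (λ y → Pt y × I y l) ys) → length (cone ys pys) ≡ length ys * pred n
    length-cone []                = refl
    length-cone ((py , yl) ∷ pys) =
      trans (length-++ (punctured x₀ _))
            (cong₂ _+_ (length-punctured px₀ (proj₁ (proj₂ (ray py yl)))) (length-cone pys))

    shadow : List A
    shadow = cone (Line.elements l) (Line.all l)

    length-shadow : length shadow ≡ n * pred n
    length-shadow = trans (length-cone (Line.all l)) (cong (_* pred n) (Line.length-elements l))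

    shadow-room : ∀ {zs} → Unique zs → Disjoint shadow zs → (∀ {v} → v ∈ zs → Pt v × v ≢ x₀) →
                  n * pred n + length zs < n * n
    shadow-room {zs} unique disjoint zs-points =
      begin-strict
        n * pred n + length zs    ≡⟨ cong (_+ length zs) length-shadow ⟨
        length shadow + length zs ≡⟨ length-++ shadow ⟨
        length (shadow ++ zs)     <⟨ ⊆⇒length≤ all-unique Points.unique all-points ⟩
        length Points.elements    ≡⟨ Points.length-elements ⟩
        n * n                     ∎
      where
      open ≤-Reasoning

      point≢x₀ : ∀ {v} → v ∈ shadow ++ zs → Pt v × v ≢ x₀
      point≢x₀ v∈ with ∈-++⁻ shadow v∈
      ... | inj₁ v∈s = let pv , v≢x₀ , _ = ∈-cone⁻ {pys = Line.all l} v∈s in pv , v≢x₀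
      ... | inj₂ v∈z = zs-points v∈z

      all-unique : Unique (x₀ ∷ shadow ++ zs)
      all-unique = All.tabulate (λ v∈ x₀≡v → proj₂ (point≢x₀ v∈) (sym x₀≡v))
                 ∷ Unique.++⁺ (cone-unique (Line.all l) (Line.unique l)) unique disjoint

      all-points : x₀ ∷ shadow ++ zs ⊆ Points.elements
      all-points (here refl) = Points.complete px₀
      all-points (there v∈)  = Points.complete (proj₁ (point≢x₀ v∈))

    parallel : ∃[ m ] (I x₀ m × Parallel l m)
    parallel =
      let x , px , x∉ = point-outside {x₀ ∷ shadow} x₀∷shadow-unique
                          (subst (λ k → suc k < n * n) (sym length-shadow) (suc-n*pred-n<n*n 1<n))
          x₀≢x = λ x₀≡x → x∉ (here (sym x₀≡x))
          m , x₀m , xm = join px₀ px x₀≢x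
      in m , x₀m , λ ((y , py) , yl , ym) →
           x∉ (there (∈-cone⁺ (Line.complete l (py , yl)) x₀m ym px (x₀≢x ∘ sym) xm))
      where
      x₀∷shadow-unique : Unique (x₀ ∷ shadow)
      x₀∷shadow-unique =
        All.tabulate (λ v∈ x₀≡v → proj₁ (proj₂ (∈-cone⁻ {pys = Line.all l} v∈)) (sym x₀≡v))
        ∷ cone-unique (Line.all l) (Line.unique l)

    shadow-disjoint : ∀ {m} → I x₀ m → Parallel l m → Disjoint shadow (punctured x₀ m)
    shadow-disjoint x₀m ∥m (v∈s , v∈m) =
      let _ , vm , _ = ∈-punctured⁻ v∈m
          y , y∈l , ym = proj₂ (proj₂ (∈-cone⁻ {pys = Line.all l} v∈s)) x₀m vm
          py , yl = All.lookup (Line.all l) y∈l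
      in ∥m ((y , py) , yl , ym)

    two-parallels-meet : ∀ {m m′} → I x₀ m → Parallel l m → I x₀ m′ → Parallel l m′ →
                         ¬ Disjoint (punctured x₀ m) (punctured x₀ m′)
    two-parallels-meet {m} {m′} x₀m ∥m x₀m′ ∥m′ disjoint =
      n*pred-n+2*pred-n≮n*n 1<n (subst (λ k → n * pred n + k < n * n) length-both
        (shadow-room (Unique.++⁺ (punctured-unique x₀ m) (punctured-unique x₀ m′) disjoint)
                     shadow-disjoint-both points-both))
      where
      both : List A
      both = punctured x₀ m ++ punctured x₀ m′

      length-both : length both ≡ pred n + pred n
      length-both = trans (length-++ (punctured x₀ m))
                          (cong₂ _+_ (length-punctured px₀ x₀m) (length-punctured px₀ x₀m′))

      shadow-disjoint-both : Disjoint shadow both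
      shadow-disjoint-both (v∈s , v∈both) with ∈-++⁻ (punctured x₀ m) v∈both
      ... | inj₁ v∈m  = shadow-disjoint x₀m ∥m (v∈s , v∈m)
      ... | inj₂ v∈m′ = shadow-disjoint x₀m′ ∥m′ (v∈s , v∈m′)

      points-both : ∀ {v} → v ∈ both → Pt v × v ≢ x₀
      points-both v∈both with ∈-++⁻ (punctured x₀ m) v∈both
      ... | inj₁ v∈m  = let pv , _ , v≢x₀ = ∈-punctured⁻ v∈m  in pv , v≢x₀
      ... | inj₂ v∈m′ = let pv , _ , v≢x₀ = ∈-punctured⁻ v∈m′ in pv , v≢x₀

    parallel-unique : ∀ {m m′} → I x₀ m → Parallel l m → I x₀ m′ → Parallel l m′ → m ≈ m′
    parallel-unique {m} {m′} x₀m ∥m x₀m′ ∥m′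
      with Any.any? (_∈? punctured x₀ m′) (punctured x₀ m)
    ... | yes common =
      let v , v∈m , v∈m′ = find common
          pv , vm , v≢x₀ = ∈-punctured⁻ v∈m
          _ , vm′ , _ = ∈-punctured⁻ v∈m′
      in join-unique px₀ pv (v≢x₀ ∘ sym) x₀m vm x₀m′ vm′
    ... | no no-common =
      contradiction (λ {v} (v∈m , v∈m′) → no-common (lose v∈m v∈m′))
                    (two-parallels-meet x₀m ∥m x₀m′ ∥m′)

  isAffinePlane : IsAffinePlaneOfOrder Point (λ u v → proj₁ u ≡ proj₁ v) L _≈_
                                       (λ u m → I (proj₁ u) m) n
  isAffinePlane = record
    { join            = λ (x , px) (y , py) x≢y → join px py x≢y
    ; join-unique     = λ (x , px) (y , py) x≢y _ _ → join-unique px py x≢y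
    ; parallel        = λ (x , px) l ¬xl → Parallels.parallel px ¬xl
    ; parallel-unique = λ (x , px) l ¬xl _ _ → Parallels.parallel-unique px ¬xl
    ; nondegenerate   = non-collinear-triple
    ; line-size       = HasExactly-Σ ∘ line-size
    }

Vect-≟ : (F : FiniteField) → DecidableEquality (PG4.Vect F)
Vect-≟ F = ≡-dec (Fin.inj⇒≟ (↔⇒↣ (FiniteField.enum F)))

module _ (F : FiniteField) {h C CPlane} (H : PG4.Hypotheses F h C CPlane) where
  open PG4 F
  open Hypotheses H

  CPlanes-linearSpace : IsLinearSpace C (_≈AL_ {CPlane}) (λ x π → proj₁ π x)
  CPlanes-linearSpace = record
    { join        = λ cx cy x≢y → let π , cπ , πx , πy = A2 _ _ cx cy x≢y in (π , cπ) , πx , πy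
    ; join-unique = λ cx cy x≢y {π} {ρ} πx πy ρx ρy →
                      A2-unique _ _ cx cy x≢y (proj₁ π) (proj₁ ρ) (proj₂ π) πx πy (proj₂ ρ) ρx ρy
    ; I-resp-≈    = λ π≐ρ → proj₁ (π≐ρ _)
    }

lemma4p1 : (F : FiniteField) → 2 ∣ FiniteField.order F → 2 < FiniteField.order F →
           (h : PG4.Vect F) → h ≢ PG4.0v F →
           (C : PG4.Vect F → Set) (CPlane : (PG4.Vect F → Set) → Set) →
           PG4.Hypotheses F h C CPlane →
           IsAffinePlaneOfOrder (PG4.APoint F C) (PG4._≈AP_ F)
                                (PG4.ALine F CPlane) (PG4._≈AL_ F)
                                (PG4.AInc F) (FiniteField.order F)
lemma4p1 F _ 2<q _ _ C CPlane H =
  SquareLinearSpace.isAffinePlane (Vect-≟ F) (CPlanes-linearSpace F H) (<⇒≤ 2<q)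
    C-size (λ (π , cπ) → A1-size π cπ)
  where open PG4.Hypotheses H
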